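{- Let $\pi$ be a projective plane of order $q$, let $2\leq n\leq q$, and consider embeddings of $G=K_{n,q}$ into $\pi$, where $V(G)=U\cup V$ is the bipartition with $|U|=n$ and $|V|=q$. Then: (a) For $n=q$, \[ n_\pi(K_{q,q})=\binom{q^2+q+1}{2}. \] (b) If $n<q$ and for every embedding $\phi$ of $G$ into $\pi$ the points of $\phi(V)$ lie on a line, then \[ n_\pi(K_{n,q})=2\binom{q^2+q+1}{2}\binom{q}{n}. \] (c) If $n=q-1$, then for every embedding $\phi$ of $G$ the points of $\phi(V)$ are collinear, and \[ n_\pi(K_{q-1,q})=q^2(q+1)(q^2+q+1). \]
   Context: Graphs are finite, simple and undirected. An embedding of a graph $G=(V,E)$ into a projective plane $\pi=(\mathcal P,\mathcal L,\mathcal I)$ is an injective map $\phi:V\to\mathcal P$ such that the induced map $E\to\mathcal L$, sending an edge $ab$ to the unique line through $\phi(a)$ and $\phi(b)$, is injective. Two embeddings $\phi,\psi$ are equivalent if $\psi=\phi\circ\varphi$ for some automorphism $\varphi$ of $G$; $n_\pi(G)$ denotes the number of inequivalent embeddings of $G$ into $\pi$ (equivalently, the number of distinct images $(\phi(V(G)),\overline\phi(E(G)))$ of $G$ in $\pi$). -}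

module Defs where

open import Data.Nat using (ℕ; zero; suc; _+_; _*_; _≤_; _<_)
open import Data.Nat.Combinatorics using (_C_)
open import Data.Fin using (Fin; splitAt; _↑ʳ_)
open import Data.List using (List; length; filterᵇ; allFin)
open import Data.Bool using (Bool; true; false)
open import Data.Sum using (_⊎_; inj₁; inj₂)
open import Data.Product using (Σ; ∃; ∃-syntax; _×_; _,_; proj₁)
open import Relation.Binary.PropositionalEquality using (_≡_; _≢_; refl) renaming (sym to ≡-sym)
open import Relation.Nullary using (¬_)
open import Function using (_∘_)

record ProjectivePlane (q : ℕ) : Set where
  field
    nP nL : ℕ
    inc : Fin nP → Fin nL → Bool

  _I_ : Fin nP → Fin nL → Set
  x I ℓ = inc x ℓ ≡ true

  field
    join : ∀ x y → x ≢ y → ∃[ ℓ ] (x I ℓ × y I ℓ)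
    join-unique : ∀ x y → x ≢ y → ∀ ℓ ℓ′ →
      x I ℓ → y I ℓ → x I ℓ′ → y I ℓ′ → ℓ ≡ ℓ′
    meet : ∀ ℓ ℓ′ → ℓ ≢ ℓ′ → ∃[ x ] (x I ℓ × x I ℓ′)
    meet-unique : ∀ ℓ ℓ′ → ℓ ≢ ℓ′ → ∀ x y →
      x I ℓ → x I ℓ′ → y I ℓ → y I ℓ′ → x ≡ y
    quadrangle : Σ (Fin 4 → Fin nP) λ f →
      (∀ i j → f i ≡ f j → i ≡ j) ×
      (∀ i j k → i ≢ j → j ≢ k → i ≢ k →
        ¬ (∃[ ℓ ] (f i I ℓ × f j I ℓ × f k I ℓ)))
    order : ∀ ℓ → length (filterᵇ (λ x → inc x ℓ) (allFin nP)) ≡ suc q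

  Point = Fin nP
  Line  = Fin nL

record Graph : Set₁ where
  field
    m   : ℕ
    Adj : Fin m → Fin m → Set
    sym : ∀ {a b} → Adj a b → Adj b a
    irr : ∀ {a} → ¬ Adj a a

-- K_{n,k}: vertices Fin (n + k); U = first n (inject), V = last k (n ↑ʳ _).
side : ∀ n {k} → Fin (n + k) → Bool
side n i with splitAt n i
... | inj₁ _ = true
... | inj₂ _ = false

K : ℕ → ℕ → Graph
K n k = record
  { m   = n + k
  ; Adj = λ a b → side n a ≢ side n b
  ; sym = λ p e → p (≡-sym e)
  ; irr = λ p → p refl
  }

module _ {q : ℕ} (π : ProjectivePlane q) (G : Graph) where
  open ProjectivePlane π
  open Graph G

  -- φ is injective, and the induced map E → lines (edge ab ↦ the unique
  -- line through φ a and φ b) is injective: if a line contains the images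
  -- of the ends of two edges ab and cd, then {a,b} = {c,d}.
  IsEmbedding : (Fin m → Point) → Set
  IsEmbedding φ =
    (∀ a b → φ a ≡ φ b → a ≡ b) ×
    (∀ a b c d → Adj a b → Adj c d → ∀ ℓ →
      φ a I ℓ → φ b I ℓ → φ c I ℓ → φ d I ℓ →
      (a ≡ c × b ≡ d) ⊎ (a ≡ d × b ≡ c))

  Embedding : Set
  Embedding = Σ (Fin m → Point) IsEmbedding

Automorphism : Graph → Set
Automorphism G = Σ (Fin m → Fin m) λ σ → Σ (Fin m → Fin m) λ τ →
  (∀ v → σ (τ v) ≡ v) × (∀ v → τ (σ v) ≡ v) ×
  (∀ a b → Adj a b → Adj (σ a) (σ b)) × (∀ a b → Adj (σ a) (σ b) → Adj a b)
  where open Graph G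

EquivEmb : ∀ {q} (π : ProjectivePlane q) (G : Graph) →
           Embedding π G → Embedding π G → Set
EquivEmb π G φ ψ = Σ (Automorphism G) λ ϕ → ∀ v → proj₁ ψ v ≡ proj₁ φ (proj₁ ϕ v)

-- n_π(G) = N: there are N pairwise inequivalent embeddings such that
-- every embedding is equivalent to one of them.
NumEmb : ∀ {q} (π : ProjectivePlane q) (G : Graph) → ℕ → Set
NumEmb π G N = Σ (Fin N → Embedding π G) λ es →
  (∀ i j → EquivEmb π G (es i) (es j) → i ≡ j) ×
  (∀ φ → ∃[ i ] EquivEmb π G (es i) φ)

VCollinear : ∀ {q} (π : ProjectivePlane q) (n k : ℕ) → Embedding π (K n k) → Set
VCollinear π n k φ = ∃[ ℓ ] (∀ (v : Fin k) → proj₁ φ (n ↑ʳ v) I ℓ)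
  where open ProjectivePlane π

-- An embedding of K n q (n ≥ 2) puts U on a line m: the q lines from u₀ to V and m already exhaust the
-- q + 1 lines through u₀. V avoids m, and if V lies on a line ℓ then U avoids ℓ; conversely, any injective
-- placement of U in m ∖ ℓ and of V in ℓ ∖ m is an embedding. An automorphism of K n q preserves the sides
-- or (only when n = q) swaps them, so two embeddings are equivalent iff their sides have the same images,
-- up to a swap. For n = q both sides fill their q-point sets, so a class is an unordered pair of lines; for
-- n < q it is an ordered pair (ℓ , m) with an n-subset of m ∖ ℓ. For n = q − 1 collinearity of V is forced:
-- a vertex of V off the line through two others produces three further points on m, and n + 3 > q + 1.

module Submission where

open import Defs
open import Data.Nat using (ℕ; suc; _+_; _*_; _≤_; _<_)
open import Data.Nat.Combinatorics using (_C_)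
open import Data.Product using (_×_)
open import Relation.Binary.PropositionalEquality using (_≡_)

open import Data.Nat using (zero; s≤s)
open import Data.Bool using (Bool; true; false; not; if_then_else_)
open import Data.Bool.Properties using (¬-not; not-injective; not-involutive; T-irrelevant; ⇔→≡)
open import Data.Nat.Combinatorics using (nCk+nC[k+1]≡[n+1]C[k+1]; nC1≡n; nCk≡nC[n∸k])
open import Data.Nat.Tactic.RingSolver using (solve-∀)
open import Data.Empty using (⊥-elim)
open import Data.Fin.Patterns using (0F; 1F; 2F; 3F)
open import Data.Fin using (Fin; zero; suc; splitAt; join; _↑ˡ_; _↑ʳ_; punchIn; punchOut)
open import Data.Fin.Properties as Fin
  using (_≟_; any?; 1↔⊤; +↔⊎; *↔×; injective⇒≤; splitAt-↑ˡ; splitAt-↑ʳ; splitAt-join; join-splitAt;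
         punchInᵢ≢i; punchIn-punchOut; punchOut-punchIn; punchOut-cong′)
open import Data.Fin.Permutation using (↔⇒≡)
open import Data.List as List using (length; filterᵇ)
import Data.Nat.Properties as ℕ
open import Data.Product using (Σ; ∃; ∃-syntax; _,_; proj₁; proj₂)
open import Data.Product.Function.Dependent.Propositional using (Σ-↔)
open import Data.Sum using (_⊎_; inj₁; inj₂; [_,_])
open import Data.Sum.Algebra using (⊎-cong; ⊎-comm)
open import Data.Unit using (⊤; tt)
open import Data.Vec using (Vec; []; _∷_; lookup; tabulate; replicate)
open import Data.Vec.Properties using (lookup∘tabulate; tabulate∘lookup; tabulate-cong)
open import Function using (_∘_; id)
open import Function.Bundles using (_↔_; Inverse; mk↔ₛ′; _⇔_; mk⇔; Equivalence; Injection)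
open import Function.Definitions using (Injective)
open import Function.Properties.Inverse using (↔-refl; ↔-sym; ↔-trans; ↔⇒↣)
open import Function.Construct.Composition using (_⇔-∘_)
open import Function.Construct.Symmetry using (⇔-sym)
open import Relation.Binary using (DecidableEquality)
open import Relation.Binary.PropositionalEquality
  using (_≢_; refl; sym; trans; cong; cong₂; subst; subst₂; module ≡-Reasoning)
open import Relation.Nullary using (¬_; Dec; yes; no; does)
open import Relation.Nullary.Decidable using (False; toWitnessFalse; fromWitnessFalse)

open Inverse using (to; from; strictlyInverseˡ; strictlyInverseʳ)
open Equivalence using () renaming (to to ⇔-to; from to ⇔-from)

private
  variable
    A B X : Set
    a b k n : ℕ

to-injective : (e : A ↔ B) → Injective _≡_ _≡_ (to e)
to-injective e = Injection.injective (↔⇒↣ e)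

from-injective : (e : A ↔ B) → Injective _≡_ _≡_ (from e)
from-injective e = to-injective (↔-sym e)

≡⇒Fin↔ : a ≡ b → Fin a ↔ Fin b
≡⇒Fin↔ refl = ↔-refl

Σ-constant↔ : {P : A → Set} → A ↔ Fin a → (∀ {x} → P x ↔ Fin k) → Σ A P ↔ Fin (a * k)
Σ-constant↔ A↔ P↔ = ↔-trans (Σ-↔ A↔ P↔) (↔-sym *↔×)

-- Subsets are cut out by Boolean tests (x ≡ true here, False (x ≟ a) below) rather than by negations: membership
-- proofs are then irrelevant, so elements of a subset are equal once their underlying elements are, without funext.
≡true-irrelevant : {x : Bool} (p p′ : x ≡ true) → p ≡ p′
≡true-irrelevant refl refl = refl

Subtype : (Fin n → Bool) → Set
Subtype {n} p = Σ (Fin n) λ x → p x ≡ true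

Subtype-≡ : {p : Fin n → Bool} {x y : Subtype p} → proj₁ x ≡ proj₁ y → x ≡ y
Subtype-≡ {x = x , px} {.x , py} refl = cong (x ,_) (≡true-irrelevant px py)

Subtype-≟ : {p : Fin n → Bool} → DecidableEquality (Subtype p)
Subtype-≟ (x , _) (y , _) with x ≟ y
... | yes x≡y = yes (Subtype-≡ x≡y)
... | no x≢y  = no (x≢y ∘ cong proj₁)

countᵇ : (Fin n → Bool) → ℕ
countᵇ {zero}  p = 0
countᵇ {suc n} p = if p zero then suc (countᵇ (p ∘ suc)) else countᵇ (p ∘ suc)

length-filterᵇ-tabulate : (f : Fin n → A) (p : A → Bool) →
  length (filterᵇ p (List.tabulate f)) ≡ countᵇ (p ∘ f)
length-filterᵇ-tabulate {zero}  f p = refl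
length-filterᵇ-tabulate {suc n} f p with p (f zero)
... | true  = cong suc (length-filterᵇ-tabulate (f ∘ suc) p)
... | false = length-filterᵇ-tabulate (f ∘ suc) p

Σ-Fin-suc↔ : {P : Fin (suc n) → Set} → Σ (Fin (suc n)) P ↔ (P zero ⊎ Σ (Fin n) (P ∘ suc))
Σ-Fin-suc↔ = mk↔ₛ′
  (λ { (zero , p) → inj₁ p ; (suc i , p) → inj₂ (i , p) })
  [ (zero ,_) , (λ (i , p) → suc i , p) ]
  (λ { (inj₁ p) → refl ; (inj₂ (i , p)) → refl })
  (λ { (zero , p) → refl ; (suc i , p) → refl })

Fin-suc↔ : Fin (suc k) ↔ (⊤ ⊎ Fin k)
Fin-suc↔ = mk↔ₛ′
  (λ { zero → inj₁ tt ; (suc i) → inj₂ i })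
  [ (λ _ → zero) , suc ]
  (λ { (inj₁ tt) → refl ; (inj₂ i) → refl })
  (λ { zero → refl ; (suc i) → refl })

Subtype↔ : (p : Fin n → Bool) → Subtype p ↔ Fin (countᵇ p)
Subtype↔ {zero}  p = mk↔ₛ′ (λ ()) (λ ()) (λ ()) (λ ())
Subtype↔ {suc n} p = ↔-trans Σ-Fin-suc↔ (add-head (p zero) (Subtype↔ (p ∘ suc)))
  where
  add-head : ∀ b {c} → X ↔ Fin c → ((b ≡ true) ⊎ X) ↔ Fin (if b then suc c else c)
  add-head true  X↔ = ↔-trans (⊎-cong (mk↔ₛ′ _ (λ _ → refl) (λ _ → refl) (≡true-irrelevant refl)) X↔)
                              (↔-sym Fin-suc↔)
  add-head false X↔ = ↔-trans (mk↔ₛ′ [ (λ ()) , id ] inj₂ (λ _ → refl) [ (λ ()) , (λ _ → refl) ]) X↔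

module _ {A : Set} (_≟ᴬ_ : DecidableEquality A) where

  Without : A → Set
  Without a = Σ A λ x → False (x ≟ᴬ a)

  Without-≡ : {a : A} {x y : Without a} → proj₁ x ≡ proj₁ y → x ≡ y
  Without-≡ {x = x , px} {.x , py} refl = cong (x ,_) (T-irrelevant px py)

  Without↔ : A ↔ Fin (suc k) → (a : A) → Without a ↔ Fin k
  Without↔ e a = mk↔ₛ′ to′ from′ to∘from′ from∘to′
    where
    distinct : {x : A} → False (x ≟ᴬ a) → to e a ≢ to e x
    distinct x≢a eq = toWitnessFalse x≢a (sym (to-injective e eq))
    to′ : Without a → Fin _
    to′ (x , x≢a) = punchOut (distinct x≢a)
    from′ : Fin _ → Without a
    from′ i = from e (punchIn (to e a) i) , fromWitnessFalse λ eq →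
      punchInᵢ≢i (to e a) i (trans (sym (strictlyInverseˡ e _)) (cong (to e) eq))
    to∘from′ : ∀ i → to′ (from′ i) ≡ i
    to∘from′ i = trans (punchOut-cong′ (to e a) (strictlyInverseˡ e _)) (punchOut-punchIn (to e a))
    from∘to′ : ∀ x → from′ (to′ x) ≡ x
    from∘to′ (x , x≢a) =
      Without-≡ (trans (cong (from e) (punchIn-punchOut (distinct x≢a))) (strictlyInverseʳ e x))

  ⊤⊎Without↔ : (a : A) → A ↔ (⊤ ⊎ Without a)
  ⊤⊎Without↔ a = mk↔ₛ′ (λ x → split x (x ≟ᴬ a)) back to∘from′ from∘to′
    where
    split : ∀ x → Dec (x ≡ a) → ⊤ ⊎ Without a
    split x (yes _)   = inj₁ tt
    split x (no x≢a) = inj₂ (x , fromWitnessFalse x≢a)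
    back : ⊤ ⊎ Without a → A
    back = [ (λ _ → a) , proj₁ ]
    from∘to′ : ∀ x → back (split x (x ≟ᴬ a)) ≡ x
    from∘to′ x with x ≟ᴬ a
    ... | yes x≡a = sym x≡a
    ... | no _    = refl
    split-other : ∀ {x} (x≢a : False (x ≟ᴬ a)) (d : Dec (x ≡ a)) → split x d ≡ inj₂ (x , x≢a)
    split-other x≢a (yes x≡a) = ⊥-elim (toWitnessFalse x≢a x≡a)
    split-other x≢a (no _)    = cong inj₂ (Without-≡ refl)
    to∘from′ : ∀ y → split (back y) (back y ≟ᴬ a) ≡ y
    to∘from′ (inj₁ tt) with a ≟ᴬ a
    ... | yes _  = refl
    ... | no a≢a = ⊥-elim (a≢a refl)
    to∘from′ (inj₂ (x , x≢a)) = split-other x≢a (x ≟ᴬ a)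

Image : (Fin k → X) → X → Set
Image f x = ∃[ i ] f i ≡ x

_⊆ᵢ_ : (Fin a → X) → (Fin b → X) → Set
f ⊆ᵢ g = ∀ i → Image g (f i)

⊆ᵢ-all : {f : Fin a → X} {g : Fin b → X} (P : X → Set) → (∀ j → P (g j)) → f ⊆ᵢ g → ∀ i → P (f i)
⊆ᵢ-all P all-g f⊆g i = subst P (proj₂ (f⊆g i)) (all-g (proj₁ (f⊆g i)))

⊆ᵢ-Image : {f : Fin a → X} {g : Fin b → X} {x : X} → f ⊆ᵢ g → Image f x → Image g x
⊆ᵢ-Image f⊆g (i , refl) = f⊆g i

Image-cong : {f g : Fin a → X} {x : X} → (∀ i → f i ≡ g i) → Image f x ⇔ Image g x
Image-cong f≡g = mk⇔ (λ (i , eq) → i , trans (sym (f≡g i)) eq) (λ (i , eq) → i , trans (f≡g i) eq)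

Image-∘-injective : {h : B → X} {f : Fin a → B} {x : B} → Injective _≡_ _≡_ h →
  Image (h ∘ f) (h x) ⇔ Image f x
Image-∘-injective h-inj = mk⇔ (λ (i , eq) → i , h-inj eq) (λ (i , eq) → i , cong _ eq)

⊆ᵢ⇒≤ : {f : Fin a → X} {g : Fin b → X} → Injective _≡_ _≡_ f → f ⊆ᵢ g → a ≤ b
⊆ᵢ⇒≤ {g = g} f-inj f⊆g = injective⇒≤ {f = proj₁ ∘ f⊆g} λ {i} {i′} eq →
  f-inj (trans (sym (proj₂ (f⊆g i))) (trans (cong g eq) (proj₂ (f⊆g i′))))

⊆ᵢ-antisym⇒permutation : {f g : Fin k → X} → Injective _≡_ _≡_ f → Injective _≡_ _≡_ g →
  f ⊆ᵢ g → g ⊆ᵢ f → Σ (Fin k ↔ Fin k) λ σ → ∀ i → f i ≡ g (to σ i)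
⊆ᵢ-antisym⇒permutation f-inj g-inj f⊆g g⊆f =
  mk↔ₛ′ σ τ (λ j → g-inj (trans (proj₂ (f⊆g (τ j))) (proj₂ (g⊆f j))))
            (λ i → f-inj (trans (proj₂ (g⊆f (σ i))) (proj₂ (f⊆g i)))) ,
  λ i → sym (proj₂ (f⊆g i))
  where
  σ = λ i → proj₁ (f⊆g i)
  τ = λ j → proj₁ (g⊆f j)

[,]-injective : {f : Fin a → X} {g : Fin b → X} → Injective _≡_ _≡_ f → Injective _≡_ _≡_ g →
  (∀ i j → f i ≢ g j) → Injective _≡_ _≡_ [ f , g ]
[,]-injective f-inj g-inj disjoint {inj₁ i} {inj₁ i′} eq = cong inj₁ (f-inj eq)
[,]-injective f-inj g-inj disjoint {inj₁ i} {inj₂ j}  eq = ⊥-elim (disjoint i j eq)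
[,]-injective f-inj g-inj disjoint {inj₂ j} {inj₁ i}  eq = ⊥-elim (disjoint i j (sym eq))
[,]-injective f-inj g-inj disjoint {inj₂ j} {inj₂ j′} eq = cong inj₂ (g-inj eq)

disjoint-injections⇒≤ : A ↔ Fin k → {f : Fin a → A} {g : Fin b → A} →
  Injective _≡_ _≡_ f → Injective _≡_ _≡_ g → (∀ i j → f i ≢ g j) → a + b ≤ k
disjoint-injections⇒≤ {a = a} e {f} {g} f-inj g-inj disjoint =
  injective⇒≤ {f = to e ∘ [ f , g ] ∘ splitAt a} λ eq →
    to-injective +↔⊎ ([,]-injective f-inj g-inj disjoint (to-injective e eq))

injective⇒surjective : A ↔ Fin k → (f : Fin k → A) → Injective _≡_ _≡_ f → ∀ x → Image f x
injective⇒surjective {k = k} e f f-inj x with any? (λ i → to e (f i) ≟ to e x)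
... | yes (i , eq) = i , to-injective e eq
... | no missed    = ⊥-elim (ℕ.<-irrefl refl (ℕ.≤-trans (ℕ.≤-reflexive (ℕ.+-comm 1 k)) too-many))
  where
  too-many : k + 1 ≤ k
  too-many = disjoint-injections⇒≤ e f-inj (λ _ → to-injective Fin.1↔⊤ refl)
               (λ i zero eq → missed (i , cong (to e) eq))

two-distinct : 2 ≤ k → Σ (Fin k) λ x → Σ (Fin k) λ y → x ≢ y
two-distinct (s≤s (s≤s _)) = zero , suc zero , λ ()

pair : X → X → Fin 2 → X
pair x y 0F = x
pair x y 1F = y

Image-pair-comm : {x y z : X} → Image (pair x y) z ⇔ Image (pair y x) z
Image-pair-comm = mk⇔ swap01 swap01
  where
  swap01 : ∀ {x y z : X} → Image (pair x y) z → Image (pair y x) z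
  swap01 (0F , eq) = 1F , eq
  swap01 (1F , eq) = 0F , eq

pair-injective : {x y : X} → x ≢ y → Injective _≡_ _≡_ (pair x y)
pair-injective x≢y {0F} {0F} _  = refl
pair-injective x≢y {0F} {1F} eq = ⊥-elim (x≢y eq)
pair-injective x≢y {1F} {0F} eq = ⊥-elim (x≢y (sym eq))
pair-injective x≢y {1F} {1F} _  = refl

triple : X → X → X → Fin 3 → X
triple x y z 0F = x
triple x y z 1F = y
triple x y z 2F = z

triple-injective : {x y z : X} → x ≢ y → x ≢ z → y ≢ z → Injective _≡_ _≡_ (triple x y z)
triple-injective x≢y x≢z y≢z {0F} {0F} _  = refl
triple-injective x≢y x≢z y≢z {0F} {1F} eq = ⊥-elim (x≢y eq)
triple-injective x≢y x≢z y≢z {0F} {2F} eq = ⊥-elim (x≢z eq)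
triple-injective x≢y x≢z y≢z {1F} {0F} eq = ⊥-elim (x≢y (sym eq))
triple-injective x≢y x≢z y≢z {1F} {1F} _  = refl
triple-injective x≢y x≢z y≢z {1F} {2F} eq = ⊥-elim (y≢z eq)
triple-injective x≢y x≢z y≢z {2F} {0F} eq = ⊥-elim (x≢z (sym eq))
triple-injective x≢y x≢z y≢z {2F} {1F} eq = ⊥-elim (y≢z (sym eq))
triple-injective x≢y x≢z y≢z {2F} {2F} _  = refl

record _Represents_ (S : Vec Bool n) (P : Fin n → Set) : Set where
  constructor represents
  field marked⇔ : ∀ i → (lookup S i ≡ true) ⇔ P i
open _Represents_

does≡true⇔ : {P : Set} (P? : Dec P) → (does P? ≡ true) ⇔ P
does≡true⇔ (yes p)  = mk⇔ (λ _ → p) (λ _ → refl)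
does≡true⇔ (no ¬p) = mk⇔ (λ ()) (λ p → ⊥-elim (¬p p))

represent : {P : Fin n → Set} → (∀ i → Dec (P i)) → Σ (Vec Bool n) (_Represents P)
represent P? = tabulate (does ∘ P?) , represents λ i →
  does≡true⇔ (P? i) ⇔-∘ mk⇔ (trans (sym (lookup∘tabulate _ i))) (trans (lookup∘tabulate _ i))

lookup-injective : {S S′ : Vec A n} → (∀ i → lookup S i ≡ lookup S′ i) → S ≡ S′
lookup-injective {S = S} {S′} eq =
  trans (sym (tabulate∘lookup S)) (trans (tabulate-cong eq) (tabulate∘lookup S′))

represents-unique : {S S′ : Vec Bool n} {P : Fin n → Set} → S Represents P → S′ Represents P → S ≡ S′
represents-unique S⇔ S′⇔ = lookup-injective λ i → ⇔→≡ (⇔-sym (marked⇔ S′⇔ i) ⇔-∘ marked⇔ S⇔ i)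

represents-⇔ : {S : Vec Bool n} {P Q : Fin n → Set} → (∀ i → P i ⇔ Q i) → S Represents P → S Represents Q
represents-⇔ P⇔Q S⇔P = represents λ i → P⇔Q i ⇔-∘ marked⇔ S⇔P i

count-image : {S : Vec Bool n} {f : Fin k → Fin n} →
  Injective _≡_ _≡_ f → S Represents Image f → countᵇ (lookup S) ≡ k
count-image {S = S} {f} f-inj S⇔ = ↔⇒≡ (↔-trans (↔-sym (Subtype↔ (lookup S))) marked↔)
  where
  marked↔ : Subtype (lookup S) ↔ Fin _
  marked↔ = mk↔ₛ′ (λ (x , sx) → proj₁ (⇔-to (marked⇔ S⇔ x) sx))
                  (λ i → f i , ⇔-from (marked⇔ S⇔ (f i)) (i , refl))
    (λ i → f-inj (proj₂ (⇔-to (marked⇔ S⇔ (f i)) _)))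
    (λ (x , sx) → Subtype-≡ (proj₂ (⇔-to (marked⇔ S⇔ x) sx)))

SubsetOfSize : ℕ → ℕ → Set
SubsetOfSize n r = Σ (Vec Bool n) λ S → countᵇ (lookup S) ≡ r

subset-enumeration : ∀ {r} (S : Vec Bool n) → countᵇ (lookup S) ≡ r →
  Σ (Fin r → Fin n) λ f → Injective _≡_ _≡_ f × S Represents Image f
subset-enumeration S refl = proj₁ ∘ from e , (from-injective e ∘ Subtype-≡) , represents λ x →
  mk⇔ (λ sx → to e (x , sx) , cong proj₁ (strictlyInverseʳ e (x , sx)))
      (λ { (i , refl) → proj₂ (from e i) })
  where e = Subtype↔ (lookup S)

SubsetOfSize-≡ : {r : ℕ} {x y : SubsetOfSize n r} → proj₁ x ≡ proj₁ y → x ≡ y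
SubsetOfSize-≡ {x = S , p} {.S , p′} refl = cong (S ,_) (ℕ.≡-irrelevant p p′)

SubsetOfSize↔ : ∀ n r → SubsetOfSize n r ↔ Fin (n C r)
SubsetOfSize↔ n       zero    = mk↔ₛ′ (λ _ → zero) (λ _ → replicate n false , count-none n)
  (λ { zero → refl }) (λ (S , p) → SubsetOfSize-≡ (sym (count≡0⇒none S p)))
  where
  count-none : ∀ n → countᵇ (lookup (replicate n false)) ≡ 0
  count-none zero    = refl
  count-none (suc n) = count-none n
  count≡0⇒none : ∀ {n} (S : Vec Bool n) → countᵇ (lookup S) ≡ 0 → S ≡ replicate n false
  count≡0⇒none []          _ = refl
  count≡0⇒none (false ∷ S) p = cong (false ∷_) (count≡0⇒none S p)
SubsetOfSize↔ zero    (suc r) = mk↔ₛ′ (λ { ([] , ()) }) (λ ()) (λ ()) (λ { ([] , ()) })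
SubsetOfSize↔ (suc n) (suc r) =
  ↔-trans pascal (↔-trans (⊎-cong (SubsetOfSize↔ n r) (SubsetOfSize↔ n (suc r)))
    (↔-trans (↔-sym +↔⊎) (≡⇒Fin↔ (nCk+nC[k+1]≡[n+1]C[k+1] n r))))
  where
  pascal : SubsetOfSize (suc n) (suc r) ↔ (SubsetOfSize n r ⊎ SubsetOfSize n (suc r))
  pascal = mk↔ₛ′
    (λ { (true ∷ S , p) → inj₁ (S , ℕ.suc-injective p) ; (false ∷ S , p) → inj₂ (S , p) })
    [ (λ (S , p) → true ∷ S , cong suc p) , (λ (S , p) → false ∷ S , p) ]
    (λ { (inj₁ (S , p)) → cong inj₁ (SubsetOfSize-≡ refl) ; (inj₂ (S , p)) → refl })
    (λ { (true ∷ S , p) → SubsetOfSize-≡ refl ; (false ∷ S , p) → refl })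

isLeft : A ⊎ B → Bool
isLeft (inj₁ _) = true
isLeft (inj₂ _) = false

side≡isLeft∘splitAt : ∀ n (a : Fin (n + k)) → side n a ≡ isLeft (splitAt n a)
side≡isLeft∘splitAt n a with splitAt n a
... | inj₁ _ = refl
... | inj₂ _ = refl

side-join : ∀ n (x : Fin n ⊎ Fin k) → side n (join n k x) ≡ isLeft x
side-join {k} n x = trans (side≡isLeft∘splitAt n (join n k x)) (cong isLeft (splitAt-join n k x))

side-↑ˡ : ∀ n (i : Fin n) → side n (i ↑ˡ k) ≡ true
side-↑ˡ n i = side-join n (inj₁ i)

side-↑ʳ : ∀ n (j : Fin k) → side n (n ↑ʳ j) ≡ false
side-↑ʳ n j = side-join n (inj₂ j)

vertex-elim : ∀ n (P : Fin (n + k) → Set) → (∀ i → P (i ↑ˡ k)) → (∀ j → P (n ↑ʳ j)) → ∀ a → P a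
vertex-elim {k} n P on-U on-V a = subst P (join-splitAt n k a) (elim (splitAt n a))
  where
  elim : ∀ x → P (join n k x)
  elim (inj₁ i) = on-U i
  elim (inj₂ j) = on-V j

true≢false : true ≢ false
true≢false ()

side≡true⇒inU : ∀ n (a : Fin (n + k)) → side n a ≡ true → ∃[ i ] a ≡ i ↑ˡ k
side≡true⇒inU n = vertex-elim n _
  (λ i _ → i , refl) (λ j eq → ⊥-elim (true≢false (trans (sym eq) (side-↑ʳ n j))))

side≡false⇒inV : ∀ n (a : Fin (n + k)) → side n a ≡ false → ∃[ j ] a ≡ n ↑ʳ j
side≡false⇒inV n = vertex-elim n _
  (λ i eq → ⊥-elim (true≢false (trans (sym (side-↑ˡ n i)) eq))) (λ j _ → j , refl)

↑ˡ-adjacent-↑ʳ : ∀ n (i : Fin n) (j : Fin k) → Graph.Adj (K n k) (i ↑ˡ k) (n ↑ʳ j)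
↑ˡ-adjacent-↑ʳ n i j eq = true≢false (trans (sym (side-↑ˡ n i)) (trans eq (side-↑ʳ n j)))

↑ˡ≢↑ʳ : ∀ n (i : Fin n) (j : Fin k) → i ↑ˡ k ≢ n ↑ʳ j
↑ˡ≢↑ʳ n i j eq = ↑ˡ-adjacent-↑ʳ n i j (cong (side n) eq)

data Edge (n k : ℕ) : Fin (n + k) → Fin (n + k) → Set where
  uv : ∀ i j → Edge n k (i ↑ˡ k) (n ↑ʳ j)
  vu : ∀ i j → Edge n k (n ↑ʳ j) (i ↑ˡ k)

edge : ∀ n {a b : Fin (n + k)} → Graph.Adj (K n k) a b → Edge n k a b
edge {k} n {a} {b} = vertex-elim n (λ a → ∀ b → Graph.Adj (K n k) a b → Edge n k a b)
  (λ i → vertex-elim n _ (λ i′ i~i′ → ⊥-elim (i~i′ (trans (side-↑ˡ n i) (sym (side-↑ˡ n i′)))))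
                         (λ j _ → uv i j))
  (λ j → vertex-elim n _ (λ i _ → vu i j)
                         (λ j′ j~j′ → ⊥-elim (j~j′ (trans (side-↑ʳ n j) (sym (side-↑ʳ n j′))))))
  a b

PreservesSides SwapsSides : ∀ n → (Fin (n + k) → Fin (n + k)) → Set
PreservesSides n σ = ∀ a → side n (σ a) ≡ side n a
SwapsSides     n σ = ∀ a → side n (σ a) ≡ not (side n a)

-- Every vertex of U is adjacent to every vertex of V, so σ maps U to one side and V to the other.
preservesSides⊎swapsSides : ∀ n → Fin n → Fin k → (ϕ : Automorphism (K n k)) →
  PreservesSides n (proj₁ ϕ) ⊎ SwapsSides n (proj₁ ϕ)
preservesSides⊎swapsSides {k} n i₀ j₀ (σ , _ , _ , _ , preserves , _) =
  by-side-of-V (side n (σ (n ↑ʳ j₀))) U-side V-side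
  where
  U-side : ∀ i → side n (σ (i ↑ˡ k)) ≡ not (side n (σ (n ↑ʳ j₀)))
  U-side i = ¬-not (preserves _ _ (↑ˡ-adjacent-↑ʳ n i j₀))
  V-side : ∀ j → side n (σ (n ↑ʳ j)) ≡ side n (σ (n ↑ʳ j₀))
  V-side j = trans (¬-not (λ e → preserves _ _ (↑ˡ-adjacent-↑ʳ n i₀ j) (sym e)))
                   (trans (cong not (U-side i₀)) (not-involutive _))
  by-side-of-V : ∀ b → (∀ i → side n (σ (i ↑ˡ k)) ≡ not b) → (∀ j → side n (σ (n ↑ʳ j)) ≡ b) →
    PreservesSides n σ ⊎ SwapsSides n σ
  by-side-of-V false on-U on-V = inj₁ (vertex-elim n _
    (λ i → trans (on-U i) (sym (side-↑ˡ n i))) (λ j → trans (on-V j) (sym (side-↑ʳ n j))))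
  by-side-of-V true  on-U on-V = inj₂ (vertex-elim n _
    (λ i → trans (on-U i) (cong not (sym (side-↑ˡ n i))))
    (λ j → trans (on-V j) (cong not (sym (side-↑ʳ n j)))))

module _ {n k : ℕ} (e : (Fin n ⊎ Fin k) ↔ (Fin n ⊎ Fin k))
         (h : Bool → Bool) (h-injective : Injective _≡_ _≡_ h) (isLeft-to : ∀ x → isLeft (to e x) ≡ h (isLeft x))
         where

  onVertices : Fin (n + k) → Fin (n + k)
  onVertices a = join n k (to e (splitAt n a))

  side-onVertices : ∀ a → side n (onVertices a) ≡ h (side n a)
  side-onVertices a = trans (side-join n (to e (splitAt n a)))
    (trans (isLeft-to (splitAt n a)) (cong h (sym (side≡isLeft∘splitAt n a))))

  automorphism : Automorphism (K n k)
  automorphism = onVertices , (λ a → join n k (from e (splitAt n a))) ,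
    (λ a → trans (cong (join n k ∘ to e) (splitAt-join n k _))
                 (trans (cong (join n k) (strictlyInverseˡ e _)) (join-splitAt n k a))) ,
    (λ a → trans (cong (join n k ∘ from e) (splitAt-join n k _))
                 (trans (cong (join n k) (strictlyInverseʳ e _)) (join-splitAt n k a))) ,
    (λ a b a~b eq → a~b (h-injective (trans (sym (side-onVertices a)) (trans eq (side-onVertices b))))) ,
    (λ a b σa~σb eq → σa~σb (trans (side-onVertices a) (trans (cong h eq) (sym (side-onVertices b)))))

module _ {q : ℕ} (π : ProjectivePlane q) where
  open ProjectivePlane π hiding (join)

  EquivEmb-sym : {G : Graph} {φ ψ : Embedding π G} → EquivEmb π G φ ψ → EquivEmb π G ψ φ
  EquivEmb-sym {G} {φ} ((σ , τ , στ , τσ , preserves , reflects) , ψ≡φ∘σ) =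
    (τ , σ , τσ , στ ,
     (λ a b a~b → reflects (τ a) (τ b) (subst₂ Adj (sym (στ a)) (sym (στ b)) a~b)) ,
     (λ a b τa~τb → subst₂ Adj (στ a) (στ b) (preserves _ _ τa~τb))) ,
    λ a → trans (cong (proj₁ φ) (sym (στ a))) (sym (ψ≡φ∘σ (τ a)))
    where open Graph G using (Adj)

  record Classification (G : Graph) (C : Set) : Set₁ where
    field
      _HasCode_      : Embedding π G → C → Set
      code           : ∀ φ → ∃ (φ HasCode_)
      code-unique    : ∀ {φ c c′} → φ HasCode c → φ HasCode c′ → c ≡ c′
      realise        : ∀ c → Σ (Embedding π G) (_HasCode c)
      code-invariant : ∀ {φ ψ c} → EquivEmb π G φ ψ → φ HasCode c → ψ HasCode c
      code-complete  : ∀ {φ ψ c} → φ HasCode c → ψ HasCode c → EquivEmb π G φ ψ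

  numEmb-from-classification : {G : Graph} {C : Set} {N : ℕ} → Classification G C → C ↔ Fin N →
    NumEmb π G N
  numEmb-from-classification {G} cl C↔ = embedding , distinct , exhaustive
    where
    open Classification cl
    embedding : Fin _ → Embedding π G
    embedding i = proj₁ (realise (from C↔ i))
    distinct : ∀ i j → EquivEmb π G (embedding i) (embedding j) → i ≡ j
    distinct i j eq = from-injective C↔
      (code-unique (code-invariant eq (proj₂ (realise (from C↔ i)))) (proj₂ (realise (from C↔ j))))
    exhaustive : ∀ φ → ∃[ i ] EquivEmb π G (embedding i) φ
    exhaustive φ = to C↔ c , code-complete
      (subst (λ c′ → proj₁ (realise c′) HasCode c) (sym (strictlyInverseʳ C↔ c)) (proj₂ (realise c)))
      (proj₂ (code φ))
      where c = proj₁ (code φ)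

  module _ {n k : ℕ} where

    uOf : Embedding π (K n k) → Fin n → Point
    uOf φ i = proj₁ φ (i ↑ˡ k)

    vOf : Embedding π (K n k) → Fin k → Point
    vOf φ j = proj₁ φ (n ↑ʳ j)

    uOf-injective : (φ : Embedding π (K n k)) → Injective _≡_ _≡_ (uOf φ)
    uOf-injective φ eq = Fin.↑ˡ-injective k _ _ (proj₁ (proj₂ φ) _ _ eq)

    vOf-injective : (φ : Embedding π (K n k)) → Injective _≡_ _≡_ (vOf φ)
    vOf-injective φ eq = Fin.↑ʳ-injective n _ _ (proj₁ (proj₂ φ) _ _ eq)

    uOf≢vOf : (φ : Embedding π (K n k)) → ∀ i j → uOf φ i ≢ vOf φ j
    uOf≢vOf φ i j eq = ↑ˡ≢↑ʳ n i j (proj₁ (proj₂ φ) _ _ eq)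

    equiv⇒images : {φ ψ : Embedding π (K n k)} → Fin n → Fin k → EquivEmb π (K n k) φ ψ →
      (uOf ψ ⊆ᵢ uOf φ × vOf ψ ⊆ᵢ vOf φ) ⊎ (uOf ψ ⊆ᵢ vOf φ × vOf ψ ⊆ᵢ uOf φ)
    equiv⇒images {φ} {ψ} i₀ j₀ (ϕ , ψ≡φ∘σ) = by-sides (preservesSides⊎swapsSides n i₀ j₀ ϕ)
      where
      image : ∀ {A : Set} {a} {f : A → Fin (n + k)} → ∃[ x ] proj₁ ϕ a ≡ f x → ∃[ x ] proj₁ φ (f x) ≡ proj₁ ψ a
      image (x , eq) = x , sym (trans (ψ≡φ∘σ _) (cong (proj₁ φ) eq))
      by-sides : PreservesSides n (proj₁ ϕ) ⊎ SwapsSides n (proj₁ ϕ) →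
        (uOf ψ ⊆ᵢ uOf φ × vOf ψ ⊆ᵢ vOf φ) ⊎ (uOf ψ ⊆ᵢ vOf φ × vOf ψ ⊆ᵢ uOf φ)
      by-sides (inj₁ preserves) =
        inj₁ ((λ i → image (side≡true⇒inU n _ (trans (preserves _) (side-↑ˡ n i)))) ,
              (λ j → image (side≡false⇒inV n _ (trans (preserves _) (side-↑ʳ n j)))))
      by-sides (inj₂ swaps) =
        inj₂ ((λ i → image (side≡false⇒inV n _ (trans (swaps _) (cong not (side-↑ˡ n i))))) ,
              (λ j → image (side≡true⇒inU n _ (trans (swaps _) (cong not (side-↑ʳ n j))))))

    equiv-from-bijection : {φ ψ : Embedding π (K n k)} (e : (Fin n ⊎ Fin k) ↔ (Fin n ⊎ Fin k))
      (h : Bool → Bool) → Injective _≡_ _≡_ h → (∀ x → isLeft (to e x) ≡ h (isLeft x)) →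
      (∀ x → proj₁ ψ (join n k x) ≡ proj₁ φ (join n k (to e x))) → EquivEmb π (K n k) φ ψ
    equiv-from-bijection {ψ = ψ} e h h-injective isLeft-to on-joins =
      automorphism e h h-injective isLeft-to ,
      λ a → trans (cong (proj₁ ψ) (sym (join-splitAt n k a))) (on-joins (splitAt n a))

    equiv⇒images-< : {φ ψ : Embedding π (K n k)} → n < k → Fin n → Fin k → EquivEmb π (K n k) φ ψ →
      uOf ψ ⊆ᵢ uOf φ × vOf ψ ⊆ᵢ vOf φ
    equiv⇒images-< {φ} {ψ} n<k i₀ j₀ φ~ψ with equiv⇒images {φ = φ} {ψ} i₀ j₀ φ~ψ
    ... | inj₁ same-sides  = same-sides
    ... | inj₂ (_ , ψV⊆φU) = ⊥-elim (ℕ.<⇒≱ n<k (⊆ᵢ⇒≤ (vOf-injective ψ) ψV⊆φU))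

    images⇒equiv : {φ ψ : Embedding π (K n k)} → uOf ψ ⊆ᵢ uOf φ → uOf φ ⊆ᵢ uOf ψ →
      vOf ψ ⊆ᵢ vOf φ → vOf φ ⊆ᵢ vOf ψ → EquivEmb π (K n k) φ ψ
    images⇒equiv {φ} {ψ} ψU⊆φU φU⊆ψU ψV⊆φV φV⊆ψV =
      equiv-from-bijection {φ = φ} {ψ} (⊎-cong (proj₁ α) (proj₁ β)) id id
        (λ { (inj₁ _) → refl ; (inj₂ _) → refl })
        (λ { (inj₁ i) → proj₂ α i ; (inj₂ j) → proj₂ β j })
      where
      α = ⊆ᵢ-antisym⇒permutation (uOf-injective ψ) (uOf-injective φ) ψU⊆φU φU⊆ψU
      β = ⊆ᵢ-antisym⇒permutation (vOf-injective ψ) (vOf-injective φ) ψV⊆φV φV⊆ψV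

  swapped-images⇒equiv : {n : ℕ} {φ ψ : Embedding π (K n n)} → uOf ψ ⊆ᵢ vOf φ → vOf φ ⊆ᵢ uOf ψ →
    vOf ψ ⊆ᵢ uOf φ → uOf φ ⊆ᵢ vOf ψ → EquivEmb π (K n n) φ ψ
  swapped-images⇒equiv {φ = φ} {ψ} ψU⊆φV φV⊆ψU ψV⊆φU φU⊆ψV =
    equiv-from-bijection {φ = φ} {ψ} (↔-trans (⊎-cong (proj₁ α) (proj₁ β)) (⊎-comm _ _)) not not-injective
      (λ { (inj₁ _) → refl ; (inj₂ _) → refl })
      (λ { (inj₁ i) → proj₂ α i ; (inj₂ j) → proj₂ β j })
    where
    α = ⊆ᵢ-antisym⇒permutation (uOf-injective ψ) (vOf-injective φ) ψU⊆φV φV⊆ψU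
    β = ⊆ᵢ-antisym⇒permutation (vOf-injective ψ) (uOf-injective φ) ψV⊆φU φU⊆ψV

  _∉_ : Point → Line → Set
  x ∉ ℓ = inc x ℓ ≡ false

  ∉⇒¬I : ∀ {x ℓ} → x ∉ ℓ → ¬ (x I ℓ)
  ∉⇒¬I x∉ℓ xIℓ = true≢false (trans (sym xIℓ) x∉ℓ)

  ¬I⇒∉ : ∀ {x ℓ} → ¬ (x I ℓ) → x ∉ ℓ
  ¬I⇒∉ {x} {ℓ} ¬xIℓ with inc x ℓ
  ... | true  = ⊥-elim (¬xIℓ refl)
  ... | false = refl

  I⊎∉ : ∀ x ℓ → x I ℓ ⊎ x ∉ ℓ
  I⊎∉ x ℓ with inc x ℓ
  ... | true  = inj₁ refl
  ... | false = inj₂ refl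

  I-∉⇒≢ : ∀ {x y ℓ} → x I ℓ → y ∉ ℓ → x ≢ y
  I-∉⇒≢ xIℓ y∉ℓ refl = ∉⇒¬I y∉ℓ xIℓ

  I-∉⇒≢ˡ : ∀ {x ℓ m} → x I ℓ → x ∉ m → ℓ ≢ m
  I-∉⇒≢ˡ xIℓ x∉m refl = ∉⇒¬I x∉m xIℓ

  line : (x y : Point) → x ≢ y → Line
  line x y x≢y = proj₁ (ProjectivePlane.join π x y x≢y)

  line-I₁ : ∀ {x y} (x≢y : x ≢ y) → x I line x y x≢y
  line-I₁ x≢y = proj₁ (proj₂ (ProjectivePlane.join π _ _ x≢y))

  line-I₂ : ∀ {x y} (x≢y : x ≢ y) → y I line x y x≢y
  line-I₂ x≢y = proj₂ (proj₂ (ProjectivePlane.join π _ _ x≢y))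

  lines-equal : ∀ {x y ℓ m} → x ≢ y → x I ℓ → y I ℓ → x I m → y I m → ℓ ≡ m
  lines-equal x≢y = join-unique _ _ x≢y _ _

  line-unique : ∀ {x y ℓ} (x≢y : x ≢ y) → x I ℓ → y I ℓ → line x y x≢y ≡ ℓ
  line-unique x≢y = lines-equal x≢y (line-I₁ x≢y) (line-I₂ x≢y)

  point : (ℓ m : Line) → ℓ ≢ m → Point
  point ℓ m ℓ≢m = proj₁ (meet ℓ m ℓ≢m)

  point-I₁ : ∀ {ℓ m} (ℓ≢m : ℓ ≢ m) → point ℓ m ℓ≢m I ℓ
  point-I₁ ℓ≢m = proj₁ (proj₂ (meet _ _ ℓ≢m))

  point-I₂ : ∀ {ℓ m} (ℓ≢m : ℓ ≢ m) → point ℓ m ℓ≢m I m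
  point-I₂ ℓ≢m = proj₂ (proj₂ (meet _ _ ℓ≢m))

  points-equal : ∀ {x y ℓ m} → ℓ ≢ m → x I ℓ → x I m → y I ℓ → y I m → x ≡ y
  points-equal ℓ≢m = meet-unique _ _ ℓ≢m _ _

  PointsOn : Line → Set
  PointsOn ℓ = Subtype (λ x → inc x ℓ)

  LinesThrough : Point → Set
  LinesThrough x = Subtype (inc x)

  PointsOn↔ : ∀ ℓ → PointsOn ℓ ↔ Fin (suc q)
  PointsOn↔ ℓ = ↔-trans (Subtype↔ _)
    (≡⇒Fin↔ (trans (sym (length-filterᵇ-tabulate {nP} id (λ x → inc x ℓ))) (order ℓ)))

  -- With f₀, …, f₃ the quadrangle: if x lies on f₀f₁ and f₀f₂ then x = f₀, which is not on f₁f₃.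
  line-avoiding : ∀ x → ∃[ ℓ ] x ∉ ℓ
  line-avoiding x = avoid (I⊎∉ x l₀₁) (I⊎∉ x l₀₂)
    where
    f = proj₁ quadrangle
    no-three = proj₂ (proj₂ quadrangle)
    l : (i j : Fin 4) → i ≢ j → Line
    l i j i≢j = line (f i) (f j) (i≢j ∘ proj₁ (proj₂ quadrangle) i j)
    l₀₁ = l 0F 1F (λ ())
    l₀₂ = l 0F 2F (λ ())
    l₁₃ = l 1F 3F (λ ())
    l₀₁≢l₀₂ : l₀₁ ≢ l₀₂
    l₀₁≢l₀₂ eq = no-three 0F 1F 2F (λ ()) (λ ()) (λ ())
      (l₀₁ , line-I₁ _ , line-I₂ _ , subst (_ I_) (sym eq) (line-I₂ _))
    avoid : x I l₀₁ ⊎ x ∉ l₀₁ → x I l₀₂ ⊎ x ∉ l₀₂ → ∃[ ℓ ] x ∉ ℓ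
    avoid (inj₂ x∉l₀₁) _               = l₀₁ , x∉l₀₁
    avoid (inj₁ _)     (inj₂ x∉l₀₂)    = l₀₂ , x∉l₀₂
    avoid (inj₁ xIl₀₁) (inj₁ xIl₀₂) = l₁₃ , ¬I⇒∉ λ xIl₁₃ → no-three 0F 1F 3F (λ ()) (λ ()) (λ ())
      (l₁₃ , subst (_I l₁₃) (points-equal l₀₁≢l₀₂ xIl₀₁ xIl₀₂ (line-I₁ _) (line-I₁ _)) xIl₁₃ ,
       line-I₁ _ , line-I₂ _)

  LinesThrough↔ : ∀ x → LinesThrough x ↔ Fin (suc q)
  LinesThrough↔ x = ↔-trans (mk↔ₛ′ to′ from′ to∘from′ from∘to′) (PointsOn↔ ℓ′)
    where
    ℓ′ = proj₁ (line-avoiding x)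
    x∉ℓ′ = proj₂ (line-avoiding x)
    to′ : LinesThrough x → PointsOn ℓ′
    to′ (L , xIL) = point L ℓ′ (I-∉⇒≢ˡ xIL x∉ℓ′) , point-I₂ _
    from′ : PointsOn ℓ′ → LinesThrough x
    from′ (y , yIℓ′) = line x y (I-∉⇒≢ yIℓ′ x∉ℓ′ ∘ sym) , line-I₁ _
    to∘from′ : ∀ y → to′ (from′ y) ≡ y
    to∘from′ (y , yIℓ′) =
      Subtype-≡ (points-equal (I-∉⇒≢ˡ (line-I₁ _) x∉ℓ′) (point-I₁ _) (point-I₂ _) (line-I₂ _) yIℓ′)
    from∘to′ : ∀ L → from′ (to′ L) ≡ L
    from∘to′ (L , xIL) = Subtype-≡ (line-unique _ xIL (point-I₁ _))

  -- Every line other than ℓ₀ meets ℓ₀ in exactly one point x, and is one of the q other lines through x.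
  #lines : nL ≡ suc (suc q * q)
  #lines = ↔⇒≡ (↔-trans (⊤⊎Without↔ _≟_ ℓ₀) (↔-trans (⊎-cong ↔-refl others↔) (↔-sym Fin-suc↔)))
    where
    ℓ₀ : Line
    ℓ₀ = proj₁ (line-avoiding (proj₁ quadrangle zero))
    Others : PointsOn ℓ₀ → Set
    Others (x , xIℓ₀) = Without Subtype-≟ (ℓ₀ , xIℓ₀)
    Others-≡ : {x x′ : PointsOn ℓ₀} {L : Others x} {L′ : Others x′} →
      x ≡ x′ → proj₁ (proj₁ L) ≡ proj₁ (proj₁ L′) → (x , L) ≡ (x′ , L′)
    Others-≡ refl eq = cong (_ ,_) (Without-≡ Subtype-≟ (Subtype-≡ eq))
    by-meet : Without _≟_ ℓ₀ ↔ Σ (PointsOn ℓ₀) Others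
    by-meet = mk↔ₛ′
      (λ (L , L≢ℓ₀) → let L≢ℓ₀ = toWitnessFalse L≢ℓ₀ in
        (point L ℓ₀ L≢ℓ₀ , point-I₂ L≢ℓ₀) , (L , point-I₁ L≢ℓ₀) ,
        fromWitnessFalse (L≢ℓ₀ ∘ cong proj₁))
      (λ (_ , (L , _) , L≢ℓ₀) → L , fromWitnessFalse (toWitnessFalse L≢ℓ₀ ∘ Subtype-≡))
      (λ ((x , xIℓ₀) , (L , xIL) , L≢ℓ₀) → Others-≡ (Subtype-≡
        (points-equal (toWitnessFalse L≢ℓ₀ ∘ Subtype-≡) (point-I₁ _) (point-I₂ _) xIL xIℓ₀)) refl)
      (λ _ → Without-≡ _≟_ refl)
    others↔ : Without _≟_ ℓ₀ ↔ Fin (suc q * q)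
    others↔ = ↔-trans by-meet
      (Σ-constant↔ (PointsOn↔ ℓ₀) λ {(x , xIℓ₀)} → Without↔ Subtype-≟ (LinesThrough↔ x) (ℓ₀ , xIℓ₀))

  module _ {ℓ m : Line} (ℓ≢m : ℓ ≢ m) where

    private
      ℓ∩m : PointsOn m
      ℓ∩m = point ℓ m ℓ≢m , point-I₂ ℓ≢m

      Off↔ : Without Subtype-≟ ℓ∩m ↔ Fin q
      Off↔ = Without↔ Subtype-≟ (PointsOn↔ m) ℓ∩m

      asOff : ∀ {x} → x I m → x ∉ ℓ → Without Subtype-≟ ℓ∩m
      asOff xIm x∉ℓ = (_ , xIm) ,
        fromWitnessFalse λ eq → ∉⇒¬I x∉ℓ (subst (_I ℓ) (sym (cong proj₁ eq)) (point-I₁ ℓ≢m))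

    offPoint : Fin q → Point
    offPoint i = proj₁ (proj₁ (from Off↔ i))

    offPoint-I : ∀ i → offPoint i I m
    offPoint-I i = proj₂ (proj₁ (from Off↔ i))

    offPoint-∉ : ∀ i → offPoint i ∉ ℓ
    offPoint-∉ i = ¬I⇒∉ λ offPointIℓ → toWitnessFalse (proj₂ (from Off↔ i))
      (Subtype-≡ (points-equal ℓ≢m offPointIℓ (offPoint-I i) (point-I₁ ℓ≢m) (point-I₂ ℓ≢m)))

    offPoint-injective : Injective _≡_ _≡_ offPoint
    offPoint-injective eq = from-injective Off↔ (Without-≡ Subtype-≟ (Subtype-≡ eq))

    injective-fills : (f : Fin q → Point) → Injective _≡_ _≡_ f → (∀ i → f i I m) → (∀ i → f i ∉ ℓ) →
      ∀ {x} → x I m → x ∉ ℓ → Image f x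
    injective-fills f f-injective fIm f∉ℓ xIm x∉ℓ
      with injective⇒surjective Off↔ (λ i → asOff (fIm i) (f∉ℓ i))
             (λ eq → f-injective (cong (proj₁ ∘ proj₁) eq)) (asOff xIm x∉ℓ)
    ... | i , eq = i , cong (proj₁ ∘ proj₁) eq

    offPoint-surjective : ∀ {x} → x I m → x ∉ ℓ → Image offPoint x
    offPoint-surjective = injective-fills offPoint offPoint-injective offPoint-I offPoint-∉

  module _ {n k : ℕ} where

    EdgeRigid : (Fin n → Point) → (Fin k → Point) → Set
    EdgeRigid u v = ∀ {L i j i′ j′} → u i I L → v j I L → u i′ I L → v j′ I L → i ≡ i′ × j ≡ j′

    embedding-edgeRigid : (φ : Embedding π (K n k)) → EdgeRigid (uOf φ) (vOf φ)
    embedding-edgeRigid φ uiIL vjIL ui′IL vj′IL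
      with proj₂ (proj₂ φ) _ _ _ _ (↑ˡ-adjacent-↑ʳ n _ _) (↑ˡ-adjacent-↑ʳ n _ _) _ uiIL vjIL ui′IL vj′IL
    ... | inj₁ (eq₁ , eq₂) = Fin.↑ˡ-injective k _ _ eq₁ , Fin.↑ʳ-injective n _ _ eq₂
    ... | inj₂ (eq , _)    = ⊥-elim (↑ˡ≢↑ʳ n _ _ eq)

    edgeRigid⇒edgeInjective : (f : Fin (n + k) → Point) → EdgeRigid (f ∘ (_↑ˡ k)) (f ∘ (n ↑ʳ_)) →
      ∀ a b c d → Graph.Adj (K n k) a b → Graph.Adj (K n k) c d → ∀ L →
      f a I L → f b I L → f c I L → f d I L → (a ≡ c × b ≡ d) ⊎ (a ≡ d × b ≡ c)
    edgeRigid⇒edgeInjective f rigid a b c d a~b c~d L faIL fbIL fcIL fdIL with edge n a~b | edge n c~d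
    ... | uv i j | uv i′ j′ with refl , refl ← rigid faIL fbIL fcIL fdIL = inj₁ (refl , refl)
    ... | uv i j | vu i′ j′ with refl , refl ← rigid faIL fbIL fdIL fcIL = inj₂ (refl , refl)
    ... | vu i j | uv i′ j′ with refl , refl ← rigid fbIL faIL fcIL fdIL = inj₂ (refl , refl)
    ... | vu i j | vu i′ j′ with refl , refl ← rigid fbIL faIL fdIL fcIL = inj₁ (refl , refl)

    embedding-from : (u : Fin n → Point) (v : Fin k → Point) → Injective _≡_ _≡_ u → Injective _≡_ _≡_ v →
      (∀ i j → u i ≢ v j) → EdgeRigid u v →
      Σ (Embedding π (K n k)) λ φ → (∀ i → uOf φ i ≡ u i) × (∀ j → vOf φ j ≡ v j)
    embedding-from u v u-inj v-inj u≢v rigid =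
      (f , (λ a b eq → to-injective +↔⊎ ([,]-injective u-inj v-inj u≢v eq)) ,
           edgeRigid⇒edgeInjective f λ {L} {i} {j} {i′} {j′} a b c d →
             rigid (subst (_I L) (f-u i) a) (subst (_I L) (f-v j) b)
                   (subst (_I L) (f-u i′) c) (subst (_I L) (f-v j′) d)) ,
      f-u , f-v
      where
      f : Fin (n + k) → Point
      f a = [ u , v ] (splitAt n a)
      f-u : ∀ i → f (i ↑ˡ k) ≡ u i
      f-u i = cong [ u , v ] (splitAt-↑ˡ n i k)
      f-v : ∀ j → f (n ↑ʳ j) ≡ v j
      f-v j = cong [ u , v ] (splitAt-↑ʳ n k j)

    record OnLinePair (φ : Embedding π (K n k)) (ℓ m : Line) : Set where
      field
        u-I : ∀ i → uOf φ i I m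
        u-∉ : ∀ i → uOf φ i ∉ ℓ
        v-I : ∀ j → vOf φ j I ℓ
        v-∉ : ∀ j → vOf φ j ∉ m

    open OnLinePair

    OnLinePair⇒≢ : {φ : Embedding π (K n k)} {ℓ m : Line} → Fin k → OnLinePair φ ℓ m → ℓ ≢ m
    OnLinePair⇒≢ j φ∈ℓm = I-∉⇒≢ˡ (v-I φ∈ℓm j) (v-∉ φ∈ℓm j)

    OnLinePair-unique : {φ : Embedding π (K n k)} {ℓ m ℓ′ m′ : Line} {i₀ i₁ : Fin n} {j₀ j₁ : Fin k} →
      i₀ ≢ i₁ → j₀ ≢ j₁ → OnLinePair φ ℓ m → OnLinePair φ ℓ′ m′ → ℓ ≡ ℓ′ × m ≡ m′
    OnLinePair-unique {φ} {i₀ = i₀} {i₁} {j₀} {j₁} i₀≢i₁ j₀≢j₁ φ∈ℓm φ∈ℓ′m′ =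
      lines-equal (j₀≢j₁ ∘ vOf-injective φ) (v-I φ∈ℓm j₀) (v-I φ∈ℓm j₁) (v-I φ∈ℓ′m′ j₀) (v-I φ∈ℓ′m′ j₁) ,
      lines-equal (i₀≢i₁ ∘ uOf-injective φ) (u-I φ∈ℓm i₀) (u-I φ∈ℓm i₁) (u-I φ∈ℓ′m′ i₀) (u-I φ∈ℓ′m′ i₁)

    OnLinePair-⊆ᵢ : {φ ψ : Embedding π (K n k)} {ℓ m : Line} →
      OnLinePair φ ℓ m → uOf ψ ⊆ᵢ uOf φ → vOf ψ ⊆ᵢ vOf φ → OnLinePair ψ ℓ m
    OnLinePair-⊆ᵢ {ℓ = ℓ} {m} φ∈ℓm ψU⊆φU ψV⊆φV = record
      { u-I = ⊆ᵢ-all (_I m) (u-I φ∈ℓm) ψU⊆φU ; u-∉ = ⊆ᵢ-all (_∉ ℓ) (u-∉ φ∈ℓm) ψU⊆φU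
      ; v-I = ⊆ᵢ-all (_I ℓ) (v-I φ∈ℓm) ψV⊆φV ; v-∉ = ⊆ᵢ-all (_∉ m) (v-∉ φ∈ℓm) ψV⊆φV }

    onLinePair-from : {ℓ m : Line} → ℓ ≢ m → (u : Fin n → Point) (v : Fin k → Point) →
      Injective _≡_ _≡_ u → Injective _≡_ _≡_ v →
      (∀ i → u i I m) → (∀ i → u i ∉ ℓ) → (∀ j → v j I ℓ) → (∀ j → v j ∉ m) →
      Σ (Embedding π (K n k)) λ φ → OnLinePair φ ℓ m × (∀ i → uOf φ i ≡ u i)
    onLinePair-from {ℓ} {m} ℓ≢m u v u-inj v-inj uIm u∉ℓ vIℓ v∉m =
      φ , record { u-I = on (_I m) φ-u uIm ; u-∉ = on (_∉ ℓ) φ-u u∉ℓ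
                 ; v-I = on (_I ℓ) φ-v vIℓ ; v-∉ = on (_∉ m) φ-v v∉m } , φ-u
      where
      rigid : EdgeRigid u v
      rigid uiIL vjIL ui′IL vj′IL =
        u-inj (points-equal (I-∉⇒≢ˡ vjIL (v∉m _)) uiIL (uIm _) ui′IL (uIm _)) ,
        v-inj (points-equal (I-∉⇒≢ˡ uiIL (u∉ℓ _)) vjIL (vIℓ _) vj′IL (vIℓ _))
      built = embedding-from u v u-inj v-inj (λ i j → I-∉⇒≢ (uIm i) (v∉m j)) rigid
      φ = proj₁ built
      φ-u = proj₁ (proj₂ built)
      φ-v = proj₂ (proj₂ built)
      on : ∀ {a} {f g : Fin a → Point} (P : Point → Set) → (∀ i → f i ≡ g i) → (∀ i → P (g i)) → ∀ i → P (f i)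
      on P f≡g Pg i = subst P (sym (f≡g i)) (Pg i)

  open OnLinePair

  OnLinePair-swapped-⊆ᵢ : {n : ℕ} {φ ψ : Embedding π (K n n)} {ℓ m : Line} →
    OnLinePair φ ℓ m → uOf ψ ⊆ᵢ vOf φ → vOf ψ ⊆ᵢ uOf φ → OnLinePair ψ m ℓ
  OnLinePair-swapped-⊆ᵢ {ℓ = ℓ} {m} φ∈ℓm ψU⊆φV ψV⊆φU = record
    { u-I = ⊆ᵢ-all (_I ℓ) (v-I φ∈ℓm) ψU⊆φV ; u-∉ = ⊆ᵢ-all (_∉ m) (v-∉ φ∈ℓm) ψU⊆φV
    ; v-I = ⊆ᵢ-all (_I m) (u-I φ∈ℓm) ψV⊆φU ; v-∉ = ⊆ᵢ-all (_∉ ℓ) (u-∉ φ∈ℓm) ψV⊆φU }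

  fills : {ℓ m : Line} {f : Fin q → Point} → Injective _≡_ _≡_ f → (∀ i → f i I m) → (∀ i → f i ∉ ℓ) →
    {g : Fin a → Point} → (∀ i → g i I m) → (∀ i → g i ∉ ℓ) → g ⊆ᵢ f
  fills f-injective fIm f∉ℓ gIm g∉ℓ i =
    injective-fills (I-∉⇒≢ˡ (gIm i) (g∉ℓ i) ∘ sym) _ f-injective fIm f∉ℓ (gIm i) (g∉ℓ i)

  placed-embedding : ∀ {n} {ℓ m : Line} (ℓ≢m : ℓ ≢ m) (f : Fin n → Fin q) → Injective _≡_ _≡_ f →
    Σ (Embedding π (K n q)) λ φ → OnLinePair φ ℓ m × (∀ i → uOf φ i ≡ offPoint ℓ≢m (f i))
  placed-embedding ℓ≢m f f-injective = onLinePair-from ℓ≢m (offPoint ℓ≢m ∘ f) (offPoint m≢ℓ)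
    (f-injective ∘ offPoint-injective ℓ≢m) (offPoint-injective m≢ℓ)
    (offPoint-I ℓ≢m ∘ f) (offPoint-∉ ℓ≢m ∘ f) (offPoint-I m≢ℓ) (offPoint-∉ m≢ℓ)
    where m≢ℓ = ℓ≢m ∘ sym

  module _ {n : ℕ} (φ : Embedding π (K n q)) {i₀ i₁ : Fin n} (i₀≢i₁ : i₀ ≢ i₁) where

    private
      u = uOf φ
      v = vOf φ
      rigid = embedding-edgeRigid φ

    U-line : Line
    U-line = line (u i₀) (u i₁) (i₀≢i₁ ∘ uOf-injective φ)

    vOf-∉-U-line : ∀ j → v j ∉ U-line
    vOf-∉-U-line j = ¬I⇒∉ λ vjI → i₀≢i₁ (proj₁ (rigid (line-I₁ _) vjI (line-I₂ _) vjI))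

    -- Through u i₀ pass the q lines to V and U-line: a line to some u i off U-line would be one too many.
    uOf-I-U-line : ∀ i → u i I U-line
    uOf-I-U-line i with I⊎∉ (u i) U-line
    ... | inj₁ uiI = uiI
    ... | inj₂ ui∉ = ⊥-elim (ℕ.<-irrefl refl (subst (_≤ suc q) (ℕ.+-comm q 2) too-many))
      where
      L : Line
      L = line (u i₀) (u i) (I-∉⇒≢ (line-I₁ _) ui∉)
      toV : Fin q → LinesThrough (u i₀)
      toV j = line (u i₀) (v j) (uOf≢vOf φ i₀ j) , line-I₁ _
      toV-injective : Injective _≡_ _≡_ toV
      toV-injective eq = proj₂ (rigid (line-I₁ _) (line-I₂ _) (line-I₁ _)
                                      (subst (_ I_) (sym (cong proj₁ eq)) (line-I₂ _)))
      U-line≢L : U-line ≢ L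
      U-line≢L eq = ∉⇒¬I ui∉ (subst (_ I_) (sym eq) (line-I₂ _))
      disjoint : ∀ j t → toV j ≢ pair (U-line , line-I₁ _) (L , line-I₁ _) t
      disjoint j 0F eq = ∉⇒¬I (vOf-∉-U-line j) (subst (_ I_) (cong proj₁ eq) (line-I₂ _))
      disjoint j 1F eq = ∉⇒¬I ui∉ (subst (λ i′ → u i′ I U-line) i₀≡i (line-I₁ _))
        where
        uiIu₀vj = subst (_ I_) (sym (cong proj₁ eq)) (line-I₂ _)
        i₀≡i = proj₁ (rigid (line-I₁ _) (line-I₂ _) uiIu₀vj (line-I₂ _))
      too-many : q + 2 ≤ suc q
      too-many = disjoint-injections⇒≤ (LinesThrough↔ (u i₀)) toV-injective
                   (pair-injective (U-line≢L ∘ cong proj₁)) disjoint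

    uOf-∉-line-through-V : ∀ {ℓ} {j₀ j₁ : Fin q} → j₀ ≢ j₁ → (∀ j → v j I ℓ) → ∀ i → u i ∉ ℓ
    uOf-∉-line-through-V j₀≢j₁ vIℓ i = ¬I⇒∉ λ uiI → j₀≢j₁ (proj₂ (rigid uiI (vIℓ _) uiI (vIℓ _)))

    onLinePair : {j₀ j₁ : Fin q} → j₀ ≢ j₁ → VCollinear π n q φ → ∃[ ℓ ] OnLinePair φ ℓ U-line
    onLinePair j₀≢j₁ (ℓ , vIℓ) = ℓ , record
      { u-I = uOf-I-U-line ; u-∉ = uOf-∉-line-through-V j₀≢j₁ vIℓ ; v-I = vIℓ ; v-∉ = vOf-∉-U-line }

    private
      meetU : ∀ {L j} → v j I L → PointsOn U-line
      meetU {L} {j} vjIL = point L U-line (I-∉⇒≢ˡ vjIL (vOf-∉-U-line j)) , point-I₂ _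

      meetU-distinct : ∀ {L L′ j} (vjIL : v j I L) (vjIL′ : v j I L′) → L ≢ L′ → meetU vjIL ≢ meetU vjIL′
      meetU-distinct vjIL vjIL′ L≢L′ eq = L≢L′ (lines-equal (I-∉⇒≢ (point-I₂ _) (vOf-∉-U-line _))
        (point-I₁ _) vjIL (subst (_I _) (sym (cong proj₁ eq)) (point-I₁ _)) vjIL′)

      uOf-≢-meetU : ∀ {L y y′} (vyIL : v y I L) → v y′ I L → y ≢ y′ →
        ∀ i → (u i , uOf-I-U-line i) ≢ meetU vyIL
      uOf-≢-meetU vyIL vy′IL y≢y′ i eq = y≢y′ (proj₂ (rigid uiIL vyIL uiIL vy′IL))
        where uiIL = subst (_I _) (sym (cong proj₁ eq)) (point-I₁ _)

    -- If some v x is off the line V-line through v j₀ and v j₁, then V-line and the lines from v x to v j₀ and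
    -- to v j₁ meet U-line in three distinct points outside U, so U-line carries at least n + 3 points.
    vCollinear : q ≤ suc n → {j₀ j₁ : Fin q} → j₀ ≢ j₁ → VCollinear π n q φ
    vCollinear q≤1+n {j₀} {j₁} j₀≢j₁ = V-line , vOf-I-V-line
      where
      V-line = line (v j₀) (v j₁) (j₀≢j₁ ∘ vOf-injective φ)
      vOf-I-V-line : ∀ x → v x I V-line
      vOf-I-V-line x with I⊎∉ (v x) V-line
      ... | inj₁ vxI = vxI
      ... | inj₂ vx∉ = ⊥-elim (ℕ.<-irrefl refl
              (ℕ.≤-trans (subst (_≤ suc q) (ℕ.+-comm n 3) too-many) (s≤s q≤1+n)))
        where
        j₀≢x : j₀ ≢ x
        j₀≢x refl = ∉⇒¬I vx∉ (line-I₁ _)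
        j₁≢x : j₁ ≢ x
        j₁≢x refl = ∉⇒¬I vx∉ (line-I₂ _)
        L₀ = line (v j₀) (v x) (j₀≢x ∘ vOf-injective φ)
        L₁ = line (v j₁) (v x) (j₁≢x ∘ vOf-injective φ)
        V-line≢L₀ : V-line ≢ L₀
        V-line≢L₀ eq = ∉⇒¬I vx∉ (subst (_ I_) (sym eq) (line-I₂ _))
        V-line≢L₁ : V-line ≢ L₁
        V-line≢L₁ eq = ∉⇒¬I vx∉ (subst (_ I_) (sym eq) (line-I₂ _))
        L₀≢L₁ : L₀ ≢ L₁
        L₀≢L₁ eq = V-line≢L₁ (lines-equal (j₀≢j₁ ∘ vOf-injective φ) (line-I₁ _) (line-I₂ _)
                                          (subst (_ I_) eq (line-I₁ _)) (line-I₁ _))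
        too-many : n + 3 ≤ suc q
        too-many = disjoint-injections⇒≤ (PointsOn↔ U-line) {f = λ i → u i , uOf-I-U-line i}
          (uOf-injective φ ∘ cong proj₁)
          (triple-injective (meetU-distinct (line-I₁ _) (line-I₁ _) V-line≢L₀)
                            (meetU-distinct (line-I₂ _) (line-I₁ _) V-line≢L₁)
                            (meetU-distinct (line-I₂ _) (line-I₂ _) L₀≢L₁))
          λ { i 0F → uOf-≢-meetU (line-I₁ _) (line-I₂ _) j₀≢j₁ i
            ; i 1F → uOf-≢-meetU (line-I₁ _) (line-I₂ _) j₀≢x i
            ; i 2F → uOf-≢-meetU (line-I₁ _) (line-I₂ _) j₁≢x i }

  -- Part (a): an embedding of K q q is determined, up to equivalence, by the unordered pair of lines.

  module _ {x₀ x₁ : Fin q} (x₀≢x₁ : x₀ ≢ x₁) where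

    private
      same-lines : {φ ψ : Embedding π (K q q)} {ℓ m : Line} → OnLinePair φ ℓ m → OnLinePair ψ ℓ m →
        uOf ψ ⊆ᵢ uOf φ × vOf ψ ⊆ᵢ vOf φ
      same-lines {φ} φ∈ℓm ψ∈ℓm =
        fills (uOf-injective φ) (u-I φ∈ℓm) (u-∉ φ∈ℓm) (u-I ψ∈ℓm) (u-∉ ψ∈ℓm) ,
        fills (vOf-injective φ) (v-I φ∈ℓm) (v-∉ φ∈ℓm) (v-I ψ∈ℓm) (v-∉ ψ∈ℓm)

      swapped-lines : {φ ψ : Embedding π (K q q)} {ℓ m : Line} → OnLinePair φ ℓ m → OnLinePair ψ m ℓ →
        uOf ψ ⊆ᵢ vOf φ × vOf ψ ⊆ᵢ uOf φ
      swapped-lines {φ} φ∈ℓm ψ∈mℓ =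
        fills (vOf-injective φ) (v-I φ∈ℓm) (v-∉ φ∈ℓm) (u-I ψ∈mℓ) (u-∉ ψ∈mℓ) ,
        fills (uOf-injective φ) (u-I φ∈ℓm) (u-∉ φ∈ℓm) (v-I ψ∈mℓ) (v-∉ ψ∈mℓ)

    record LinePairCode (φ : Embedding π (K q q)) (c : SubsetOfSize nL 2) : Set where
      constructor linePairCode
      field
        ℓ m     : Line
        onLines : OnLinePair φ ℓ m
        marks   : proj₁ c Represents Image (pair ℓ m)

    classification-Kqq : Classification (K q q) (SubsetOfSize nL 2)
    classification-Kqq = record
      { _HasCode_ = LinePairCode ; code = code ; code-unique = code-unique ; realise = realise
      ; code-invariant = code-invariant ; code-complete = code-complete }
      where
      code : ∀ φ → ∃ (LinePairCode φ)
      code φ = (proj₁ S , count-image (pair-injective (OnLinePair⇒≢ x₀ φ∈ℓm)) (proj₂ S)) ,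
               linePairCode ℓ (U-line φ x₀≢x₁) φ∈ℓm (proj₂ S)
        where
        ℓ∈ = onLinePair φ x₀≢x₁ x₀≢x₁ (vCollinear φ x₀≢x₁ (ℕ.n≤1+n q) x₀≢x₁)
        ℓ = proj₁ ℓ∈
        φ∈ℓm = proj₂ ℓ∈
        S = represent (λ k → any? (λ t → pair ℓ (U-line φ x₀≢x₁) t ≟ k))

      code-unique : ∀ {φ c c′} → LinePairCode φ c → LinePairCode φ c′ → c ≡ c′
      code-unique (linePairCode ℓ m φ∈ℓm S⇔) (linePairCode ℓ′ m′ φ∈ℓ′m′ S′⇔)
        with OnLinePair-unique x₀≢x₁ x₀≢x₁ φ∈ℓm φ∈ℓ′m′
      ... | refl , refl = SubsetOfSize-≡ (represents-unique S⇔ S′⇔)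

      realise : ∀ c → Σ (Embedding π (K q q)) (λ φ → LinePairCode φ c)
      realise (S , |S|≡2) =
        proj₁ built , linePairCode (f 0F) (f 1F) (proj₁ (proj₂ built))
        (represents-⇔ (λ _ → Image-cong λ { 0F → refl ; 1F → refl }) (proj₂ (proj₂ enum)))
        where
        enum = subset-enumeration S |S|≡2
        f = proj₁ enum
        ℓ≢m : f 0F ≢ f 1F
        ℓ≢m eq with () ← proj₁ (proj₂ enum) eq
        built = placed-embedding ℓ≢m id id

      code-invariant : ∀ {φ ψ c} → EquivEmb π (K q q) φ ψ → LinePairCode φ c → LinePairCode ψ c
      code-invariant {φ} {ψ} φ~ψ (linePairCode ℓ m φ∈ℓm S⇔) with equiv⇒images {φ = φ} {ψ} x₀ x₀ φ~ψ
      ... | inj₁ (ψU⊆φU , ψV⊆φV) = linePairCode ℓ m (OnLinePair-⊆ᵢ φ∈ℓm ψU⊆φU ψV⊆φV) S⇔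
      ... | inj₂ (ψU⊆φV , ψV⊆φU) =
        linePairCode m ℓ (OnLinePair-swapped-⊆ᵢ φ∈ℓm ψU⊆φV ψV⊆φU) (represents-⇔ (λ _ → Image-pair-comm) S⇔)

      code-complete : ∀ {φ ψ c} → LinePairCode φ c → LinePairCode ψ c → EquivEmb π (K q q) φ ψ
      code-complete {φ} {ψ} (linePairCode ℓ m φ∈ℓm S⇔) (linePairCode ℓ′ m′ ψ∈ℓ′m′ S⇔′)
        with ⇔-to (marked⇔ S⇔ ℓ′) (⇔-from (marked⇔ S⇔′ ℓ′) (0F , refl))
           | ⇔-to (marked⇔ S⇔ m′) (⇔-from (marked⇔ S⇔′ m′) (1F , refl))
      ... | 0F , refl | 1F , refl = images⇒equiv {φ = φ} {ψ}
        (proj₁ (same-lines φ∈ℓm ψ∈ℓ′m′)) (proj₁ (same-lines ψ∈ℓ′m′ φ∈ℓm))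
        (proj₂ (same-lines φ∈ℓm ψ∈ℓ′m′)) (proj₂ (same-lines ψ∈ℓ′m′ φ∈ℓm))
      ... | 1F , refl | 0F , refl = swapped-images⇒equiv {φ = φ} {ψ}
        (proj₁ (swapped-lines φ∈ℓm ψ∈ℓ′m′)) (proj₂ (swapped-lines ψ∈ℓ′m′ φ∈ℓm))
        (proj₂ (swapped-lines φ∈ℓm ψ∈ℓ′m′)) (proj₁ (swapped-lines ψ∈ℓ′m′ φ∈ℓm))
      ... | 0F , refl | 0F , refl = ⊥-elim (OnLinePair⇒≢ x₀ ψ∈ℓ′m′ refl)
      ... | 1F , refl | 1F , refl = ⊥-elim (OnLinePair⇒≢ x₀ ψ∈ℓ′m′ refl)

  -- Part (b): an embedding of K n q with collinear V is determined by the ordered pair (ℓ , m) of lines and the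
  -- positions of U among the q points of m off ℓ.

  LinePair : Set
  LinePair = Σ Line (Without _≟_)

  distinct : ((ℓ , m , _) : LinePair) → ℓ ≢ m
  distinct (_ , _ , m≢ℓ) = toWitnessFalse m≢ℓ ∘ sym

  module _ {n : ℕ} (n<q : n < q) {i₀ i₁ : Fin n} (i₀≢i₁ : i₀ ≢ i₁) {j₀ j₁ : Fin q} (j₀≢j₁ : j₀ ≢ j₁)
           (collinear : ∀ φ → VCollinear π n q φ) where

    record PositionCode (φ : Embedding π (K n q)) (c : LinePair × SubsetOfSize q n) : Set where
      constructor positionCode
      field
        onLines : OnLinePair φ (proj₁ (proj₁ c)) (proj₁ (proj₂ (proj₁ c)))
        marks   : proj₁ (proj₂ c) Represents λ k → Image (uOf φ) (offPoint (distinct (proj₁ c)) k)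

    private
      marked-⊆ᵢ : ∀ {φ ψ c} → PositionCode φ c → PositionCode ψ c → uOf ψ ⊆ᵢ uOf φ
      marked-⊆ᵢ {c = c} (positionCode φ∈ S⇔) (positionCode ψ∈ S⇔′) i =
        let k , offPoint≡ψi = offPoint-surjective (distinct (proj₁ c)) (u-I ψ∈ i) (u-∉ ψ∈ i)
            i′ , φi′≡offPoint = ⇔-to (marked⇔ S⇔ k) (⇔-from (marked⇔ S⇔′ k) (i , sym offPoint≡ψi))
        in i′ , trans φi′≡offPoint offPoint≡ψi

    classification-Knq : Classification (K n q) (LinePair × SubsetOfSize q n)
    classification-Knq = record
      { _HasCode_ = PositionCode ; code = code ; code-unique = code-unique ; realise = realise
      ; code-invariant = code-invariant ; code-complete = code-complete }
      where
      code : ∀ φ → ∃ (PositionCode φ)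
      code φ = (lines , proj₁ S , count) , positionCode φ∈ℓm marks
        where
        ℓ∈ = onLinePair φ i₀≢i₁ j₀≢j₁ (collinear φ)
        φ∈ℓm = proj₂ ℓ∈
        lines : LinePair
        lines = proj₁ ℓ∈ , U-line φ i₀≢i₁ , fromWitnessFalse (OnLinePair⇒≢ j₀ φ∈ℓm ∘ sym)
        ℓ≢m = distinct lines
        S : Σ (Vec Bool q) (_Represents λ k → Image (uOf φ) (offPoint ℓ≢m k))
        S = represent (λ k → any? (λ i → uOf φ i ≟ offPoint ℓ≢m k))
        marks : proj₁ S Represents λ k → Image (uOf φ) (offPoint ℓ≢m k)
        marks = proj₂ S
        position : Fin n → Fin q
        position i = proj₁ (offPoint-surjective ℓ≢m (u-I φ∈ℓm i) (u-∉ φ∈ℓm i))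
        offPoint∘position : ∀ i → offPoint ℓ≢m (position i) ≡ uOf φ i
        offPoint∘position i = proj₂ (offPoint-surjective ℓ≢m (u-I φ∈ℓm i) (u-∉ φ∈ℓm i))
        position-injective : Injective _≡_ _≡_ position
        position-injective eq = uOf-injective φ
          (trans (sym (offPoint∘position _)) (trans (cong (offPoint ℓ≢m) eq) (offPoint∘position _)))
        Image⇔ : ∀ {k} → Image (uOf φ) (offPoint ℓ≢m k) ⇔ Image position k
        Image⇔ = Image-∘-injective (offPoint-injective ℓ≢m) ⇔-∘ Image-cong (sym ∘ offPoint∘position)
        count : countᵇ (lookup (proj₁ S)) ≡ n
        count = count-image {f = position} position-injective (represents-⇔ (λ k → Image⇔ {k}) marks)

      code-unique : ∀ {φ c c′} → PositionCode φ c → PositionCode φ c′ → c ≡ c′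
      code-unique {c = (ℓ , m , m≢ℓ) , _} {(ℓ′ , m′ , m′≢ℓ′) , _}
        (positionCode φ∈ℓm S⇔) (positionCode φ∈ℓ′m′ S′⇔) with OnLinePair-unique i₀≢i₁ j₀≢j₁ φ∈ℓm φ∈ℓ′m′
      ... | refl , refl with T-irrelevant m≢ℓ m′≢ℓ′
      ... | refl = cong ((ℓ , m , m≢ℓ) ,_) (SubsetOfSize-≡ (represents-unique S⇔ S′⇔))

      realise : ∀ c → Σ (Embedding π (K n q)) (λ φ → PositionCode φ c)
      realise (lines , S , |S|≡n) = proj₁ built , positionCode (proj₁ (proj₂ built))
        (represents-⇔ (λ k → Image-cong (sym ∘ proj₂ (proj₂ built)) ⇔-∘ ⇔-sym (Image-position {k}))
                      (proj₂ (proj₂ enum)))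
        where
        ℓ≢m = distinct lines
        enum = subset-enumeration S |S|≡n
        built = placed-embedding ℓ≢m (proj₁ enum) (proj₁ (proj₂ enum))
        Image-position : ∀ {k} → Image (offPoint ℓ≢m ∘ proj₁ enum) (offPoint ℓ≢m k) ⇔ Image (proj₁ enum) k
        Image-position = Image-∘-injective (offPoint-injective ℓ≢m)

      code-invariant : ∀ {φ ψ c} → EquivEmb π (K n q) φ ψ → PositionCode φ c → PositionCode ψ c
      code-invariant {φ} {ψ} φ~ψ (positionCode φ∈ℓm S⇔) =
        positionCode (OnLinePair-⊆ᵢ φ∈ℓm ψU⊆φU ψV⊆φV) (represents-⇔ (λ _ → mk⇔ (⊆ᵢ-Image φU⊆ψU) (⊆ᵢ-Image ψU⊆φU)) S⇔)
        where
        ψU⊆φU = proj₁ (equiv⇒images-< {φ = φ} {ψ} n<q i₀ j₀ φ~ψ)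
        ψV⊆φV = proj₂ (equiv⇒images-< {φ = φ} {ψ} n<q i₀ j₀ φ~ψ)
        φU⊆ψU = proj₁ (equiv⇒images-< {φ = ψ} {φ} n<q i₀ j₀ (EquivEmb-sym {G = K n q} {φ} {ψ} φ~ψ))

      code-complete : ∀ {φ ψ c} → PositionCode φ c → PositionCode ψ c → EquivEmb π (K n q) φ ψ
      code-complete {φ} {ψ} φ∈c ψ∈c = images⇒equiv {φ = φ} {ψ} (marked-⊆ᵢ φ∈c ψ∈c) (marked-⊆ᵢ ψ∈c φ∈c)
        (fills (vOf-injective φ) (v-I φ∈) (v-∉ φ∈) (v-I ψ∈) (v-∉ ψ∈))
        (fills (vOf-injective ψ) (v-I ψ∈) (v-∉ ψ∈) (v-I φ∈) (v-∉ φ∈))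
        where
        φ∈ = PositionCode.onLines φ∈c
        ψ∈ = PositionCode.onLines ψ∈c

  LinePair↔ : LinePair ↔ Fin (suc (suc q * q) * (suc q * q))
  LinePair↔ = Σ-constant↔ lines↔ λ {ℓ} → Without↔ _≟_ lines↔ ℓ
    where lines↔ = ≡⇒Fin↔ #lines

  numEmb-Kqq : 2 ≤ q → NumEmb π (K q q) (nL C 2)
  numEmb-Kqq 2≤q = numEmb-from-classification (classification-Kqq x₀≢x₁) (SubsetOfSize↔ nL 2)
    where x₀≢x₁ = proj₂ (proj₂ (two-distinct 2≤q))

  numEmb-Knq : ∀ {n} → 2 ≤ n → n < q → (∀ φ → VCollinear π n q φ) →
    NumEmb π (K n q) (suc (suc q * q) * (suc q * q) * (q C n))
  numEmb-Knq {n} 2≤n n<q collinear = numEmb-from-classification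
    (classification-Knq n<q (proj₂ (proj₂ (two-distinct 2≤n))) (proj₂ (proj₂ (two-distinct 2≤q))) collinear)
    (Σ-constant↔ LinePair↔ (SubsetOfSize↔ q n))
    where 2≤q = ℕ.≤-trans 2≤n (ℕ.<⇒≤ n<q)

  vCollinear-K[q-1]q : ∀ {n} → 2 ≤ n → suc n ≡ q → ∀ φ → VCollinear π n q φ
  vCollinear-K[q-1]q 2≤n 1+n≡q φ = vCollinear φ (proj₂ (proj₂ (two-distinct 2≤n))) (ℕ.≤-reflexive (sym 1+n≡q))
    (proj₂ (proj₂ (two-distinct (subst (2 ≤_) 1+n≡q (ℕ.m≤n⇒m≤1+n 2≤n)))))

2*[1+m]C2 : ∀ m → 2 * (suc m C 2) ≡ suc m * m
2*[1+m]C2 zero    = refl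
2*[1+m]C2 (suc m) = begin
  2 * (suc (suc m) C 2)              ≡⟨ cong (2 *_) (nCk+nC[k+1]≡[n+1]C[k+1] (suc m) 1) ⟨
  2 * (suc m C 1 + suc m C 2)        ≡⟨ ℕ.*-distribˡ-+ 2 (suc m C 1) (suc m C 2) ⟩
  2 * (suc m C 1) + 2 * (suc m C 2)  ≡⟨ cong₂ _+_ (cong (2 *_) (nC1≡n (suc m))) (2*[1+m]C2 m) ⟩
  2 * suc m + suc m * m              ≡⟨ expand m ⟩
  suc (suc m) * suc m                ∎
  where
  open ≡-Reasoning
  expand : ∀ m → 2 * suc m + suc m * m ≡ suc (suc m) * suc m
  expand = solve-∀

[1+n]Cn≡1+n : ∀ n → suc n C n ≡ suc n
[1+n]Cn≡1+n n = trans (nCk≡nC[n∸k] (ℕ.n≤1+n n)) (trans (cong (suc n C_) (ℕ.m+n∸n≡m 1 n)) (nC1≡n (suc n)))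

#lines≡ : ∀ q → suc (suc q * q) ≡ q * q + q + 1
#lines≡ = solve-∀

#linePairs≡ : ∀ q → suc (suc q * q) * (suc q * q) ≡ 2 * ((q * q + q + 1) C 2)
#linePairs≡ q = trans (sym (2*[1+m]C2 (suc q * q))) (cong (λ N → 2 * (N C 2)) (#lines≡ q))

#K[q-1]q≡ : ∀ q → suc (suc q * q) * (suc q * q) * q ≡ q * q * (q + 1) * (q * q + q + 1)
#K[q-1]q≡ = solve-∀

theorem3p5 : (q : ℕ) (π : ProjectivePlane q) →
    (2 ≤ q → NumEmb π (K q q) ((q * q + q + 1) C 2)) ×
    ((n : ℕ) → 2 ≤ n → n < q →
      (∀ φ → VCollinear π n q φ) →
      NumEmb π (K n q) (2 * ((q * q + q + 1) C 2) * (q C n))) ×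
    ((n : ℕ) → 2 ≤ n → suc n ≡ q →
      (∀ φ → VCollinear π n q φ) ×
      NumEmb π (K n q) (q * q * (q + 1) * (q * q + q + 1)))
theorem3p5 q π = part-a , part-b , part-c
  where
  part-a : 2 ≤ q → NumEmb π (K q q) ((q * q + q + 1) C 2)
  part-a 2≤q = subst (NumEmb π (K q q)) (cong (_C 2) (trans (#lines π) (#lines≡ q))) (numEmb-Kqq π 2≤q)
  part-b : ∀ n → 2 ≤ n → n < q → (∀ φ → VCollinear π n q φ) →
    NumEmb π (K n q) (2 * ((q * q + q + 1) C 2) * (q C n))
  part-b n 2≤n n<q collinear =
    subst (NumEmb π (K n q)) (cong (_* (q C n)) (#linePairs≡ q)) (numEmb-Knq π 2≤n n<q collinear)
  part-c : ∀ n → 2 ≤ n → suc n ≡ q → (∀ φ → VCollinear π n q φ) ×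
    NumEmb π (K n q) (q * q * (q + 1) * (q * q + q + 1))
  part-c n 2≤n 1+n≡q = collinear , subst (NumEmb π (K n q)) count (numEmb-Knq π 2≤n n<q collinear)
    where
    collinear = vCollinear-K[q-1]q π 2≤n 1+n≡q
    n<q = subst (n <_) 1+n≡q ℕ.≤-refl
    count = trans (cong (suc (suc q * q) * (suc q * q) *_) (subst (λ m → m C n ≡ m) 1+n≡q ([1+n]Cn≡1+n n)))
                  (#K[q-1]q≡ q)
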